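{- Let $\mathscr L$ be a simple affine oriented matroid on $E$ satisfying (S): $|S(X,Y)|<\infty$ for all $X,Y\in\mathscr L$. Let $e\in E$ and let $<$ be a total order on $\pi(e)$ such that $a<b<c$ iff $[a,b,c]$ (unique up to reversal). Then: if $(\pi(e),<)$ has neither a least nor a greatest element, it is order-isomorphic to $(\mathbb Z,<)$; if it has exactly one of a least or greatest element, then, after reversing the order if necessary so that this extremum is a least element, it is order-isomorphic to $(\mathbb N,<)$; if it has both a least and a greatest element, then $\pi(e)$ is finite, i.e. order-isomorphic to $\{0,1,\dots,|\pi(e)|-1\}$.
   Context: Sign vectors on $E$: maps $X:E\to\{+,-,0\}$; $z(X)=\{e:X(e)=0\}$, $\underline X=E\setminus z(X)$, $S(X,Y)=\{e\in\underline X\cap\underline Y:X(e)\ne Y(e)\}$, $(X\circ Y)(e)=X(e)$ if $X(e)\ne0$ else $Y(e)$, $(X\oplus Y)(e)=0$ if $e\in S(X,Y)$ else $(X\circ Y)(e)$. For $\mathscr L$: $I_e(X,Y)=\{Z\in\mathscr L:Z(e)=0,\ Z(f)=(X\circ Y)(f)\ \forall f\notin S(X,Y)\}$, $I(X,Y)=\bigcup_{e\in S(X,Y)}I_e(X,Y)$, $\mathcal P(\mathscr L)=\{X\oplus(-Y):X,Y\in\mathscr L,\ I(X,-Y)=I(-X,Y)=\emptyset\}$. AOM: (FS) $X\circ(-Y)\in\mathscr L$; (SE) $I_e(X,Y)\ne\emptyset$ for $e\in S(X,Y)$; (P) $P\circ X\in\mathscr L$ for $P\in\mathcal P(\mathscr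 L)$, $X\in\mathscr L$. $e\parallel f$ iff no $X\in\mathscr L$ has $e,f\in z(X)$. Simple: no $e$ with $X(e)=Y(e)$ for all $X,Y\in\mathscr L$; no distinct $e,f$ with $X(e)=X(f)$ for all $X$ or $X(e)=-X(f)$ for all $X$. In a simple AOM, $\pi(e)=\{e\}\cup\{f:f\parallel e\}$ is the parallelism class of $e$. For pairwise distinct $f,g,h\in\pi(e)$, $[f,g,h]$ means: for all $X,Z\in\mathscr L$ with $X(f)=0$, $Z(h)=0$, $X(g)=-Z(g)$. (A total order as in the claim exists.) -}

module Defs where

open import Level using (0ℓ)
open import Data.Product using (Σ; ∃; _×_; _,_; proj₁)
open import Data.Sum using (_⊎_)
open import Data.List using (List)
open import Data.List.Membership.Propositional using (_∈_)
open import Relation.Nullary using (¬_)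
open import Relation.Binary.PropositionalEquality using (_≡_; _≢_)
open import Relation.Binary.Core using (Rel)

data Sign : Set where
  ⊕ ⊖ 𝟘 : Sign

negS : Sign → Sign
negS ⊕ = ⊖
negS ⊖ = ⊕
negS 𝟘 = 𝟘

module _ {E : Set} where

  SV : Set
  SV = E → Sign

  neg : SV → SV
  neg X e = negS (X e)

  zeroAt : SV → E → Set
  zeroAt X e = X e ≡ 𝟘

  Sep : SV → SV → E → Set
  Sep X Y e = (X e ≢ 𝟘) × (Y e ≢ 𝟘) × (X e ≢ Y e)

  compS : Sign → Sign → Sign
  compS ⊕ _ = ⊕
  compS ⊖ _ = ⊖
  compS 𝟘 t = t

  comp : SV → SV → SV
  comp X Y e = compS (X e) (Y e)

  sumS : Sign → Sign → Sign
  sumS ⊕ ⊖ = 𝟘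
  sumS ⊖ ⊕ = 𝟘
  sumS s t = compS s t

  osum : SV → SV → SV
  osum X Y e = sumS (X e) (Y e)

  -- a set of sign vectors is a predicate on SV; it must be extensional
  -- (sign vectors equal pointwise are the same sign vector)
  Extensional : (SV → Set) → Set
  Extensional L = ∀ X Y → (∀ e → X e ≡ Y e) → L X → L Y

  Ie : (SV → Set) → SV → SV → E → SV → Set
  Ie L X Y e Z = L Z × (Z e ≡ 𝟘) × (∀ f → ¬ Sep X Y f → Z f ≡ comp X Y f)

  IEmpty : (SV → Set) → SV → SV → Set
  IEmpty L X Y = ∀ e → Sep X Y e → ∀ Z → ¬ Ie L X Y e Z

  InP : (SV → Set) → SV → Set
  InP L P = Σ SV λ X → Σ SV λ Y → L X × L Y × IEmpty L X (neg Y) × IEmpty L (neg X) Y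
            × (∀ e → P e ≡ osum X (neg Y) e)

  record IsAOM (L : SV → Set) : Set where
    field
      ext : Extensional L
      FS  : ∀ X Y → L X → L Y → L (comp X (neg Y))
      SE  : ∀ X Y → L X → L Y → ∀ e → Sep X Y e → ∃ λ Z → Ie L X Y e Z
      P   : ∀ P X → InP L P → L X → L (comp P X)

  record IsSimple (L : SV → Set) : Set where
    field
      noLoop : ∀ e → ¬ (∀ X Y → L X → L Y → X e ≡ Y e)
      noPar  : ∀ e f → e ≢ f → ¬ (∀ X → L X → X e ≡ X f)
      noAnti : ∀ e f → e ≢ f → ¬ (∀ X → L X → X e ≡ negS (X f))

  FiniteSet : (E → Set) → Set
  FiniteSet P = ∃ λ (xs : List E) → ∀ e → P e → e ∈ xs

  CondS : (SV → Set) → Set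
  CondS L = ∀ X Y → L X → L Y → FiniteSet (Sep X Y)

  _∥⟨_⟩_ : E → (SV → Set) → E → Set
  e ∥⟨ L ⟩ f = ¬ (∃ λ X → L X × X e ≡ 𝟘 × X f ≡ 𝟘)

  π : (SV → Set) → E → Set
  π L e = Σ E λ f → (f ≡ e) ⊎ (f ∥⟨ L ⟩ e)

  _≈π_ : {L : SV → Set} {e : E} → Rel (π L e) 0ℓ
  a ≈π b = proj₁ a ≡ proj₁ b

  Betw : (SV → Set) → E → E → E → Set
  Betw L f g h = ∀ X Z → L X → L Z → X f ≡ 𝟘 → Z h ≡ 𝟘 → X g ≡ negS (Z g)

module _ {A : Set} (_≈_ : Rel A 0ℓ) (_<_ : Rel A 0ℓ) where

  HasLeast : Set
  HasLeast = ∃ λ a → ∀ b → ¬ (b ≈ a) → a < b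

  HasGreatest : Set
  HasGreatest = ∃ λ a → ∀ b → ¬ (b ≈ a) → b < a

record OrderIso {A B : Set} (_≈_ : Rel A 0ℓ) (_<_ : Rel A 0ℓ) (_<′_ : Rel B 0ℓ) : Set where
  field
    to       : A → B
    from     : B → A
    to-cong  : ∀ {a a′} → a ≈ a′ → to a ≡ to a′
    to-from  : ∀ b → to (from b) ≡ b
    from-to  : ∀ a → from (to a) ≈ a
    mono     : ∀ {a a′} → a < a′ → to a <′ to a′
    reflects : ∀ {a a′} → to a <′ to a′ → a < a′

{-# OPTIONS --safe #-}
-- Distinct elements of π(e) are pairwise parallel: among any three of them one lies between
-- the other two, and [f,g,h] would then give a covector vanishing at e and at another element
-- of π(e).  Hence if X vanishes at a and Z at b, every c strictly between a and b lies in
-- S(X,Z), and (S) makes all open intervals of π(e) finite.  A total order with finite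
-- intervals is discrete: each non-maximal element has an immediate successor, and iterating it
-- from a point reaches every larger point; this yields ℤ, ℕ, reversed ℕ or a finite ordinal
-- according to which extrema exist.
module Submission where

open import Defs
open import Level using (0ℓ)
open import Axiom.ExcludedMiddle using (ExcludedMiddle)
open import Data.Product using (Σ; ∃; _×_; _,_; proj₁; proj₂)
open import Data.Sum using (_⊎_; inj₁; inj₂)
open import Data.Nat using (ℕ; zero; suc; s≤s)
open import Data.Nat.GeneralisedArithmetic using (iterate; iterate-is-fold)
open import Data.Nat.Induction using (<-wellFounded)
open import Data.Integer using (ℤ; +_; -[1+_])
open import Data.Fin using (Fin; toℕ; fromℕ<)
open import Data.List using (List; length)
open import Data.List.Relation.Unary.Any using (here; there; _─_)
open import Data.List.Membership.Propositional using (_∈_)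
open import Data.Empty using (⊥-elim)
open import Induction.WellFounded using (WellFounded; WfRec; Acc; acc; module All)
open import Relation.Nullary using (¬_; yes; no)
open import Relation.Binary.PropositionalEquality using (_≡_; _≢_; refl; cong; subst)
import Relation.Binary.PropositionalEquality as ≡
open import Relation.Binary.Core using (Rel)
open import Relation.Binary.Definitions using (Transitive; tri<; tri≈; tri>)
open import Relation.Binary.Structures using (IsStrictTotalOrder)
open import Function.Base using (flip; _on_)
import Relation.Binary.Construct.Flip.EqAndOrd as Flip
import Data.Nat as N
import Data.Integer as Z
import Data.Fin as F
import Data.Nat.Properties as NP
import Data.Integer.Properties as ZP
import Data.Fin.Properties as FP

∈-─ : {K : Set} {x y : K} {xs : List K} → y ∈ xs → (p : x ∈ xs) → y ≢ x → y ∈ (xs ─ p)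
∈-─ (here y≡z) (here x≡z) y≢x = ⊥-elim (y≢x (≡.trans y≡z (≡.sym x≡z)))
∈-─ (here y≡z) (there _)  _   = here y≡z
∈-─ (there q)  (here _)   _   = q
∈-─ (there q)  (there p)  y≢x = there (∈-─ q p y≢x)

length-─< : {K : Set} {x : K} {xs : List K} (p : x ∈ xs) → length (xs ─ p) N.< length xs
length-─< (here _)  = NP.n<1+n _
length-─< (there p) = s≤s (length-─< p)

iterate-suc : {A : Set} (f : A → A) (x : A) (n : ℕ) → iterate f x (suc n) ≡ f (iterate f x n)
iterate-suc f x n = ≡.trans (≡.sym (iterate-is-fold x f (suc n))) (cong f (iterate-is-fold x f n))

ascending : {A : Set} {_<_ : Rel A 0ℓ} → Transitive _<_ → (f : ℕ → A) {n : ℕ} →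
            (∀ {j} → j N.< n → f j < f (suc j)) → ∀ {i j} → i N.< j → j N.≤ n → f i < f j
ascending {_<_ = _<_} <-trans f step {i} {suc j} (s≤s i≤j) j<n with NP.m≤n⇒m<n∨m≡n i≤j
... | inj₁ i<j  = <-trans (ascending {_<_ = _<_} <-trans f step i<j (NP.<⇒≤ j<n)) (step j<n)
... | inj₂ refl = step j<n

Between : {A : Set} → Rel A 0ℓ → A → A → A → Set
Between _<_ a b c = (a < b × b < c) ⊎ (c < b × b < a)

Between-sym : {A : Set} {_<_ : Rel A 0ℓ} {a b c : A} → Between _<_ a b c → Between _<_ c b a
Between-sym (inj₁ abc) = inj₂ abc
Between-sym (inj₂ cba) = inj₁ cba

module StrictTotalOrderProperties {A : Set} {_≈_ _<_ : Rel A 0ℓ} (sto : IsStrictTotalOrder _≈_ _<_) where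

  open IsStrictTotalOrder sto

  <-resp₂-≈ : ∀ {x x′ y y′} → x ≈ x′ → y ≈ y′ → x < y → x′ < y′
  <-resp₂-≈ x≈x′ y≈y′ x<y = <-respʳ-≈ y≈y′ (<-respˡ-≈ x≈x′ x<y)

  Between-distinct : ∀ {a b c} → Between _<_ a b c → ¬ a ≈ b × ¬ b ≈ c × ¬ a ≈ c
  Between-distinct (inj₁ (a<b , b<c)) =
    (λ a≈b → irrefl a≈b a<b) , (λ b≈c → irrefl b≈c b<c) , (λ a≈c → irrefl a≈c (trans a<b b<c))
  Between-distinct (inj₂ (c<b , b<a)) =
    (λ a≈b → irrefl (Eq.sym a≈b) b<a) , (λ b≈c → irrefl (Eq.sym b≈c) c<b) ,
    (λ a≈c → irrefl (Eq.sym a≈c) (trans c<b b<a))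

  one-of-three-between : ∀ {x y z} → ¬ x ≈ y → ¬ y ≈ z → ¬ x ≈ z →
    Between _<_ x y z ⊎ Between _<_ y x z ⊎ Between _<_ x z y
  one-of-three-between {x} {y} {z} x≉y y≉z x≉z with compare x y | compare y z | compare x z
  ... | tri≈ _ x≈y _ | _            | _            = ⊥-elim (x≉y x≈y)
  ... | _            | tri≈ _ y≈z _ | _            = ⊥-elim (y≉z y≈z)
  ... | _            | _            | tri≈ _ x≈z _ = ⊥-elim (x≉z x≈z)
  ... | tri< x<y _ _ | tri< y<z _ _ | _            = inj₁ (inj₁ (x<y , y<z))
  ... | tri> _ _ y<x | tri> _ _ z<y | _            = inj₁ (inj₂ (z<y , y<x))
  ... | tri< x<y _ _ | tri> _ _ z<y | tri< x<z _ _ = inj₂ (inj₂ (inj₁ (x<z , z<y)))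
  ... | tri< x<y _ _ | tri> _ _ z<y | tri> _ _ z<x = inj₂ (inj₁ (inj₂ (z<x , x<y)))
  ... | tri> _ _ y<x | tri< y<z _ _ | tri< x<z _ _ = inj₂ (inj₁ (inj₁ (y<x , x<z)))
  ... | tri> _ _ y<x | tri< y<z _ _ | tri> _ _ z<x = inj₂ (inj₂ (inj₂ (y<z , z<x)))

  least-below : ∀ {m} → (∀ b → ¬ b ≈ m → m < b) → ∀ a → m < a ⊎ m ≈ a
  least-below {m} least a with m ≟ a
  ... | yes m≈a = inj₂ m≈a
  ... | no m≉a  = inj₁ (least a (λ a≈m → m≉a (Eq.sym a≈m)))

  greatest-maximal : ∀ {M} → (∀ b → ¬ b ≈ M → b < M) → ∀ {a} → ¬ M < a
  greatest-maximal greatest {a} M<a = asym M<a (greatest a (λ a≈M → irrefl (Eq.sym a≈M) M<a))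

  strictMono-onto⇒OrderIso : {B : Set} {_<′_ : Rel B 0ℓ} → IsStrictTotalOrder _≡_ _<′_ →
    (f : B → A) → (∀ {x y} → x <′ y → f x < f y) → (∀ a → ∃ λ b → f b ≈ a) → OrderIso _≈_ _<_ _<′_
  strictMono-onto⇒OrderIso {B} {_<′_} stoB f mono onto = record
    { to       = to
    ; from     = f
    ; to-cong  = λ {a} {a′} a≈a′ → injective (Eq.trans (proj₂ (onto a)) (Eq.trans a≈a′ (Eq.sym (proj₂ (onto a′)))))
    ; to-from  = λ b → injective (proj₂ (onto (f b)))
    ; from-to  = λ a → proj₂ (onto a)
    ; mono     = λ {a} {a′} a<a′ → reflect (<-resp₂-≈ (Eq.sym (proj₂ (onto a))) (Eq.sym (proj₂ (onto a′))) a<a′)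
    ; reflects = λ {a} {a′} to<to → <-resp₂-≈ (proj₂ (onto a)) (proj₂ (onto a′)) (mono to<to)
    }
    where
    module B = IsStrictTotalOrder stoB

    to : A → B
    to a = proj₁ (onto a)

    injective : ∀ {x y} → f x ≈ f y → x ≡ y
    injective {x} {y} fx≈fy with B.compare x y
    ... | tri< x<y _ _ = ⊥-elim (irrefl fx≈fy (mono x<y))
    ... | tri≈ _ x≡y _ = x≡y
    ... | tri> _ _ y<x = ⊥-elim (irrefl (Eq.sym fx≈fy) (mono y<x))

    reflect : ∀ {x y} → f x < f y → x <′ y
    reflect {x} {y} fx<fy with B.compare x y
    ... | tri< x<y _ _  = x<y
    ... | tri≈ _ refl _ = ⊥-elim (irrefl Eq.refl fx<fy)
    ... | tri> _ _ y<x  = ⊥-elim (asym fx<fy (mono y<x))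

IntervalsFinite : {A K : Set} → (A → K) → Rel A 0ℓ → Set
IntervalsFinite {K = K} key _<_ = ∀ a b → ∃ λ (ks : List K) → ∀ c → a < c → c < b → key c ∈ ks

IntervalsFinite-flip : {A K : Set} {key : A → K} {_<_ : Rel A 0ℓ} →
                       IntervalsFinite key _<_ → IntervalsFinite key (flip _<_)
IntervalsFinite-flip finite a b = proj₁ (finite b a) , λ c c<a b<c → proj₂ (finite b a) c b<c c<a

module DiscreteOrder (em : ExcludedMiddle 0ℓ) {A K : Set} (key : A → K) {_<_ : Rel A 0ℓ}
  (sto : IsStrictTotalOrder (_≡_ on key) _<_) (finite : IntervalsFinite key _<_) where

  open IsStrictTotalOrder sto
  open StrictTotalOrderProperties sto

  _≈_ : Rel A 0ℓ
  _≈_ = _≡_ on key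

  Inside : A × A → A → Set
  Inside (a , b) x = a < x × x < b

  Inside-resp-≈ : ∀ {i x y} → x ≈ y → Inside i x → Inside i y
  Inside-resp-≈ x≈y (a<x , x<b) = <-respʳ-≈ x≈y a<x , <-respˡ-≈ x≈y x<b

  _⊏_ : Rel (A × A) 0ℓ
  i ⊏ j = (∀ {x} → Inside i x → Inside j x) × ∃ λ c → Inside j c × ¬ Inside i c

  ⊏-acc : ∀ {i ks} → (∀ x → Inside i x → key x ∈ ks) → Acc N._<_ (length ks) → Acc _⊏_ i
  ⊏-acc cover (acc rs) = acc λ { (i′⊆i , c , c∈i , c∉i′) →
    let c∈ks = cover c c∈i in
    ⊏-acc (λ x x∈i′ → ∈-─ (cover x (i′⊆i x∈i′)) c∈ks (λ x≈c → c∉i′ (Inside-resp-≈ x≈c x∈i′)))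
          (rs (length-─< c∈ks)) }

  ⊏-wellFounded : WellFounded _⊏_
  ⊏-wellFounded (a , b) = ⊏-acc (λ x (a<x , x<b) → proj₂ (finite a b) x a<x x<b) (<-wellFounded _)

  open All ⊏-wellFounded 0ℓ using (wfRec)

  _⋖_ : Rel A 0ℓ
  a ⋖ b = a < b × ∀ {c} → a < c → ¬ c < b

  cover-exists : ∀ {a b} → a < b → ∃ (a ⋖_)
  cover-exists {a} {b} = wfRec P step (a , b)
    where
    P : A × A → Set
    P (a , b) = a < b → ∃ (a ⋖_)
    step : ∀ i → WfRec _⊏_ P i → P i
    step (a , b) rec a<b with em {∃ λ c → a < c × c < b}
    ... | no ∄c = b , a<b , λ a<c c<b → ∄c (_ , a<c , c<b)
    ... | yes (c , a<c , c<b) =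
      rec {a , c} ((λ (a<x , x<c) → a<x , trans x<c c<b) , c , (a<c , c<b) , λ (_ , c<c) → irrefl refl c<c) a<c

  next : A → A
  next a with em {∃ (a <_)}
  ... | yes (_ , a<b) = proj₁ (cover-exists a<b)
  ... | no _          = a

  next-covers : ∀ {a b} → a < b → a ⋖ next a
  next-covers {a} a<b with em {∃ (a <_)}
  ... | yes (_ , a<b′) = proj₂ (cover-exists a<b′)
  ... | no ∄b          = ⊥-elim (∄b (_ , a<b))

  Reaches : A → A → ℕ → Set
  Reaches a b n = iterate next a n ≈ b × ∀ {j} → j N.< n → iterate next a j < b

  reach : ∀ {a b} → a < b ⊎ a ≈ b → ∃ (Reaches a b)
  reach {a} {b} = wfRec P step (a , b)
    where
    P : A × A → Set
    P (a , b) = a < b ⊎ a ≈ b → ∃ (Reaches a b)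
    step : ∀ i → WfRec _⊏_ P i → P i
    step (a , b) rec (inj₂ a≈b) = 0 , a≈b , λ ()
    step (a , b) rec (inj₁ a<b) with from-next
      where
      a⋖s = next-covers a<b
      from-next : ∃ (Reaches (next a) b)
      from-next with compare (next a) b
      ... | tri< s<b _ _ = rec {next a , b} ((λ (s<x , x<b) → trans (proj₁ a⋖s) s<x , x<b) ,
                                             next a , (proj₁ a⋖s , s<b) , λ (s<s , _) → irrefl refl s<s)
                               (inj₁ s<b)
      ... | tri≈ _ s≈b _ = 0 , s≈b , λ ()
      ... | tri> _ _ b<s = ⊥-elim (proj₂ a⋖s a<b b<s)
    ... | n , hit , below = suc n , hit , λ { {zero} _ → a<b ; {suc j} (s≤s j<n) → below j<n }

  orbit-step : ∀ a j {b} → iterate next a j < b → iterate next a j < iterate next a (suc j)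
  orbit-step a j aⱼ<b = subst (iterate next a j <_) (≡.sym (iterate-suc next a j)) (proj₁ (next-covers aⱼ<b))

  unbounded : ¬ HasGreatest _≈_ _<_ → ∀ a → ∃ (a <_)
  unbounded ∄greatest a with em {∃ (a <_)}
  ... | yes a<b = a<b
  ... | no ∄b   = ⊥-elim (∄greatest (a , below-a))
    where
    below-a : ∀ b → ¬ b ≈ a → b < a
    below-a b b≉a with compare b a
    ... | tri< b<a _ _ = b<a
    ... | tri≈ _ b≈a _ = ⊥-elim (b≉a b≈a)
    ... | tri> _ _ a<b = ⊥-elim (∄b (b , a<b))

  orbit-strictMono : ¬ HasGreatest _≈_ _<_ → ∀ a {i j} → i N.< j → iterate next a i < iterate next a j
  orbit-strictMono ∄greatest a i<j =
    ascending {_<_ = _<_} trans (iterate next a) (λ {k} _ → orbit-step a k (proj₂ (unbounded ∄greatest (iterate next a k)))) i<j NP.≤-refl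

  ≅ℕ : HasLeast _≈_ _<_ × ¬ HasGreatest _≈_ _<_ → OrderIso _≈_ _<_ N._<_
  ≅ℕ ((m , least) , ∄greatest) =
    strictMono-onto⇒OrderIso NP.<-isStrictTotalOrder (iterate next m) (orbit-strictMono ∄greatest m) onto
    where
    onto : ∀ a → ∃ λ n → iterate next m n ≈ a
    onto a = let n , hit , _ = reach (least-below least a) in n , hit

  ≅Fin : HasLeast _≈_ _<_ × HasGreatest _≈_ _<_ → ∃ λ n → OrderIso _≈_ _<_ (F._<_ {n})
  ≅Fin ((m , least) , (M , greatest)) =
    suc n , strictMono-onto⇒OrderIso FP.<-isStrictTotalOrder f mono onto
    where
    n = proj₁ (reach (least-below least M))
    hitM = proj₁ (proj₂ (reach (least-below least M)))
    belowM = proj₂ (proj₂ (reach (least-below least M)))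

    f : Fin (suc n) → A
    f i = iterate next m (toℕ i)

    mono : ∀ {i j} → i F.< j → f i < f j
    mono {j = j} i<j = ascending {_<_ = _<_} trans (iterate next m) (λ {k} k<n → orbit-step m k (belowM k<n)) i<j (NP.≤-pred (FP.toℕ<n j))

    onto : ∀ a → ∃ λ i → f i ≈ a
    onto a with reach (least-below least a)
    ... | k , hit , below = fromℕ< k<1+n , subst (λ j → iterate next m j ≈ a) (≡.sym (FP.toℕ-fromℕ< k<1+n)) hit
      where
      k<1+n : k N.< suc n
      k<1+n = s≤s (NP.≮⇒≥ λ n<k → greatest-maximal greatest (<-respˡ-≈ hitM (below n<k)))

module _ (em : ExcludedMiddle 0ℓ) {A K : Set} (key : A → K) {_<_ : Rel A 0ℓ}
  (sto : IsStrictTotalOrder (_≡_ on key) _<_) (finite : IntervalsFinite key _<_) where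

  private
    module Up   = DiscreteOrder em key sto finite
    module Down = DiscreteOrder em key (Flip.isStrictTotalOrder sto) (IntervalsFinite-flip finite)
    open IsStrictTotalOrder sto using (compare; trans)
    open StrictTotalOrderProperties sto using (strictMono-onto⇒OrderIso)
    _≈_ = _≡_ on key

  ≅ℤ : A → ¬ HasLeast _≈_ _<_ × ¬ HasGreatest _≈_ _<_ → OrderIso _≈_ _<_ Z._<_
  ≅ℤ o (∄least , ∄greatest) = strictMono-onto⇒OrderIso ZP.<-isStrictTotalOrder f mono onto
    where
    f : ℤ → A
    f (+ n)      = iterate Up.next o n
    f -[1+ n ]   = iterate Down.next o (suc n)

    up : ∀ {i j} → i N.< j → iterate Up.next o i < iterate Up.next o j
    up = Up.orbit-strictMono ∄greatest o

    down : ∀ {i j} → i N.< j → iterate Down.next o j < iterate Down.next o i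
    down = Down.orbit-strictMono ∄least o

    mono : ∀ {x y} → x Z.< y → f x < f y
    mono (Z.-<- n<m) = down (s≤s n<m)
    mono { -[1+ m ]} {+ zero}  Z.-<+ = down {0} {suc m} (s≤s N.z≤n)
    mono { -[1+ m ]} {+ suc n} Z.-<+ = trans (down {0} {suc m} (s≤s N.z≤n)) (up {0} {suc n} (s≤s N.z≤n))
    mono (Z.+<+ m<n) = up m<n

    onto : ∀ a → ∃ λ z → f z ≈ a
    onto a with compare o a
    ... | tri< o<a _ _ = let n , hit , _ = Up.reach (inj₁ o<a) in + n , hit
    ... | tri≈ _ o≈a _ = + 0 , o≈a
    ... | tri> _ _ a<o with Down.reach (inj₁ a<o)
    ...   | zero  , hit , _ = + 0 , hit
    ...   | suc n , hit , _ = -[1+ n ] , hit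

  discrete-order-classification : A →
    (¬ HasLeast _≈_ _<_ × ¬ HasGreatest _≈_ _<_ → OrderIso _≈_ _<_ Z._<_)
    × (HasLeast _≈_ _<_ × ¬ HasGreatest _≈_ _<_ → OrderIso _≈_ _<_ N._<_)
    × (¬ HasLeast _≈_ _<_ × HasGreatest _≈_ _<_ → OrderIso _≈_ (flip _<_) N._<_)
    × (HasLeast _≈_ _<_ × HasGreatest _≈_ _<_ → Σ ℕ λ n → OrderIso _≈_ _<_ (F._<_ {n}))
  discrete-order-classification o =
    ≅ℤ o , Up.≅ℕ , (λ (∄least , greatest) → Down.≅ℕ (greatest , ∄least)) , Up.≅Fin

negS-fixed⇒𝟘 : ∀ {s} → s ≡ negS s → s ≡ 𝟘
negS-fixed⇒𝟘 {𝟘} _ = refl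

module _ {E : Set} {L : (E → Sign) → Set} where

  vanishing-covector : ExcludedMiddle 0ℓ → IsAOM L → IsSimple L → ∀ f → ∃ λ X → L X × X f ≡ 𝟘
  vanishing-covector em aom simple f with em {∃ λ X → L X × X f ≡ 𝟘}
  ... | yes vanishing = vanishing
  ... | no ∄X = ⊥-elim (IsSimple.noLoop simple f agree)
    where
    agree : ∀ X Y → L X → L Y → X f ≡ Y f
    agree X Y LX LY with em {X f ≡ Y f}
    ... | yes Xf≡Yf = Xf≡Yf
    ... | no Xf≢Yf =
      let Z , LZ , Zf≡𝟘 , _ = IsAOM.SE aom X Y LX LY f
                                ((λ Xf≡𝟘 → ∄X (X , LX , Xf≡𝟘)) , (λ Yf≡𝟘 → ∄X (Y , LY , Yf≡𝟘)) , Xf≢Yf)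
      in ⊥-elim (∄X (Z , LZ , Zf≡𝟘))

module ParallelClass (em : ExcludedMiddle 0ℓ) {E : Set} {L : (E → Sign) → Set} (aom : IsAOM L) (simple : IsSimple L)
  (e : E) {_<_ : Rel (π L e) 0ℓ} (sto : IsStrictTotalOrder _≈π_ _<_)
  (between⇒Betw : ∀ {a b c} → Between _<_ a b c → Betw L (proj₁ a) (proj₁ b) (proj₁ c)) where

  open IsStrictTotalOrder sto using (irrefl)
  open StrictTotalOrderProperties sto using (one-of-three-between)

  ê : π L e
  ê = e , inj₁ refl

  π-pairwise-parallel : ∀ {a c : π L e} → proj₁ a ≢ proj₁ c → proj₁ a ∥⟨ L ⟩ proj₁ c
  π-pairwise-parallel {_ , inj₁ refl} {_ , inj₁ refl} a≢c _ = a≢c refl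
  π-pairwise-parallel {_ , inj₁ refl} {_ , inj₂ c∥e} _ (X , LX , Xe , Xc) = c∥e (X , LX , Xc , Xe)
  π-pairwise-parallel {_ , inj₂ a∥e} {_ , inj₁ refl} _ common-zero = a∥e common-zero
  π-pairwise-parallel {a@(fa , inj₂ a∥e)} {c@(fc , inj₂ c∥e)} a≢c (X , LX , Xa , Xc)
    with one-of-three-between {a} {ê} {c} a≢e e≢c a≢c
    where
    a≢e : fa ≢ e
    a≢e refl = a∥e (X , LX , Xa , Xa)
    e≢c : e ≢ fc
    e≢c refl = c∥e (X , LX , Xc , Xc)
  ... | inj₁ aec = a∥e (X , LX , Xa , negS-fixed⇒𝟘 (between⇒Betw aec X X LX LX Xa Xc))
  ... | inj₂ (inj₁ eac) with vanishing-covector em aom simple e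
  ...   | Y , LY , Ye = a∥e (Y , LY , ≡.trans (between⇒Betw eac Y X LY LX Ye Xc) (cong negS Xa) , Ye)
  π-pairwise-parallel {a@(fa , inj₂ a∥e)} {c@(fc , inj₂ c∥e)} a≢c (X , LX , Xa , Xc)
    | inj₂ (inj₂ ace) with vanishing-covector em aom simple e
  ...   | Y , LY , Ye = c∥e (Y , LY , ≡.trans (between⇒Betw (Between-sym {_<_ = _<_} ace) Y X LY LX Ye Xa) (cong negS Xc) , Ye)

  between-separates : ∀ {a b c X Z} → L X → L Z → X (proj₁ a) ≡ 𝟘 → Z (proj₁ b) ≡ 𝟘 →
                      a < c → c < b → Sep X Z (proj₁ c)
  between-separates {a} {b} {c} {X} {Z} LX LZ Xa Zb a<c c<b = Xc≢𝟘 , Zc≢𝟘 , Xc≢Zc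
    where
    Xc≡-Zc : X (proj₁ c) ≡ negS (Z (proj₁ c))
    Xc≡-Zc = between⇒Betw (inj₁ (a<c , c<b)) X Z LX LZ Xa Zb
    Xc≢𝟘 : X (proj₁ c) ≢ 𝟘
    Xc≢𝟘 Xc≡𝟘 = π-pairwise-parallel {a} {c} (λ a≡c → irrefl a≡c a<c) (X , LX , Xa , Xc≡𝟘)
    Zc≢𝟘 : Z (proj₁ c) ≢ 𝟘
    Zc≢𝟘 Zc≡𝟘 = π-pairwise-parallel {c} {b} (λ c≡b → irrefl c≡b c<b) (Z , LZ , Zc≡𝟘 , Zb)
    Xc≢Zc : X (proj₁ c) ≢ Z (proj₁ c)
    Xc≢Zc Xc≡Zc = Zc≢𝟘 (negS-fixed⇒𝟘 (≡.trans (≡.sym Xc≡Zc) Xc≡-Zc))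

  π-intervalsFinite : CondS L → IntervalsFinite proj₁ _<_
  π-intervalsFinite condS a b
    with vanishing-covector em aom simple (proj₁ a) | vanishing-covector em aom simple (proj₁ b)
  ... | X , LX , Xa | Z , LZ , Zb =
    let ks , complete = condS X Z LX LZ
    in ks , λ c a<c c<b → complete (proj₁ c) (between-separates {a} {b} {c} LX LZ Xa Zb a<c c<b)

lemma3p29 : ExcludedMiddle 0ℓ →
    {E : Set} (L : (E → Sign) → Set) → IsAOM L → IsSimple L → CondS L →
    (e : E) (_<_ : Rel (π L e) 0ℓ) → IsStrictTotalOrder _≈π_ _<_ →
    (∀ (a b c : π L e) → proj₁ a ≢ proj₁ b → proj₁ b ≢ proj₁ c → proj₁ a ≢ proj₁ c →
       (Betw L (proj₁ a) (proj₁ b) (proj₁ c) → (a < b × b < c) ⊎ (c < b × b < a))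
       × ((a < b × b < c) ⊎ (c < b × b < a) → Betw L (proj₁ a) (proj₁ b) (proj₁ c))) →
    ((¬ HasLeast _≈π_ _<_ × ¬ HasGreatest _≈π_ _<_ → OrderIso _≈π_ _<_ Z._<_)
     × (HasLeast _≈π_ _<_ × ¬ HasGreatest _≈π_ _<_ → OrderIso _≈π_ _<_ N._<_)
     × (¬ HasLeast _≈π_ _<_ × HasGreatest _≈π_ _<_ → OrderIso _≈π_ (flip _<_) N._<_)
     × (HasLeast _≈π_ _<_ × HasGreatest _≈π_ _<_ → Σ ℕ λ n → OrderIso _≈π_ _<_ (F._<_ {n})))
lemma3p29 em L aom simple condS e _<_ sto betweenness =
  discrete-order-classification em proj₁ sto intervalsFinite ê
  where
  open StrictTotalOrderProperties sto using (Between-distinct)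

  between⇒Betw : ∀ {a b c} → Between _<_ a b c → Betw L (proj₁ a) (proj₁ b) (proj₁ c)
  between⇒Betw {a} {b} {c} abc =
    let a≢b , b≢c , a≢c = Between-distinct abc in proj₂ (betweenness a b c a≢b b≢c a≢c) abc

  open ParallelClass em aom simple e sto between⇒Betw using (ê; π-intervalsFinite)

  intervalsFinite : IntervalsFinite proj₁ _<_
  intervalsFinite = π-intervalsFinite condS
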